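{- Let $(X,I)$ be a $1$-frame satisfying O5 and O3. Then $I$ is symmetric.
   Context: A $1$-frame is a pair $(X,I)$ with $I\subseteq X\times X$; $I^2$ is the composition of $I$ with itself. O5: for all $a,b\in X$, $aI^2b$. O3: for all $a,b,c,d\in X$, $aIbIcIdIa$ (i.e. $aIb$, $bIc$, $cId$, $dIa$) implies $a=c$ or $b=d$. -}

module Defs where

open import Level using (Level; _⊔_; suc)
open import Data.Product using (Σ; _×_; ∃-syntax)
open import Data.Sum using (_⊎_)
open import Relation.Binary.PropositionalEquality using (_≡_)

record Frame1 (a ℓ : Level) : Set (Level.suc (a ⊔ ℓ)) where
  field
    X : Set a
    I : X → X → Set ℓ

module _ {a ℓ : Level} (F : Frame1 a ℓ) where
  open Frame1 F

  I² : X → X → Set (a ⊔ ℓ)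
  I² x y = ∃[ z ] (I x z × I z y)

  O5 : Set (a ⊔ ℓ)
  O5 = ∀ x y → I² x y

  O3 : Set (a ⊔ ℓ)
  O3 = ∀ p q r s → I p q → I q r → I r s → I s p → (p ≡ r) ⊎ (q ≡ s)

  Symmetric : Set (a ⊔ ℓ)
  Symmetric = ∀ x y → I x y → I y x

{-# OPTIONS --safe #-}
module Submission where

open import Level using (Level)
open import Defs
open import Data.Product using (_,_)
open import Data.Sum using (inj₁; inj₂)
open import Relation.Binary.PropositionalEquality using (refl)

-- Given x I y, O5 supplies a path y I c I s I x, closing a 4-cycle x I y I c I s I x.
-- O3 then collapses it: either x = c, so y I c is y I x, or y = s, so s I x is y I x.

module _ {a ℓ : Level} (F : Frame1 a ℓ) (o3 : O3 F) where
  open Frame1 F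

  reverse-I-of-I² : ∀ {x y c} → I x y → I y c → I² F c x → I y x
  reverse-I-of-I² {x} {y} {c} xIy yIc (s , cIs , sIx)
    with o3 x y c s xIy yIc cIs sIx
  ... | inj₁ refl = yIc
  ... | inj₂ refl = sIx

lemma4p1 : {a ℓ : Level} (F : Frame1 a ℓ) → O5 F → O3 F → Symmetric F
lemma4p1 F o5 o3 x y xIy =
  let c , yIc , _ = o5 y x in reverse-I-of-I² F o3 xIy yIc (o5 c x)
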